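{- Let $q\geq 2$ be an integer and let $S=\langle n,n+1,\dots,n+t\rangle$ with integers $\lceil\frac{n-1}{2}\rceil\leq t<n$ and $t\neq 1$. (1) If $q\leq t+1$, then $GM_q(S)=3+(q-1)n-\left\lceil\frac nq\right\rceil+t$. (2) If $t+2\leq q\leq n-1$, then $$GM_q(S)=4+(q-1)n+q-2\left\lceil\frac nq\right\rceil+\left\lfloor\frac{t+n}{q}\right\rfloor-\max\left\{\left\lfloor\frac{t+n}{q}\right\rfloor,\ \min\left\{1+\left\lfloor\frac nq\right\rfloor,\ t\right\}\right\}.$$ (3) If $n\leq q$, then $GM_q(S)=2+qn-\left\lceil\frac{2n}{q}\right\rceil+\left\lfloor\frac{t+n}{q}\right\rfloor$.
   Context: $\langle n,\dots,n+t\rangle$ is the set of $\mathbb N$-linear combinations of $n,\dots,n+t$. Write $S^*=S\setminus\{0\}$, $qS^*+S=\{qx+y: x\in S^*,\ y\in S\}$, and $GM_q(S):=\#\big(S\setminus (qS^*+S)\big)+1$. -}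

module Defs where

open import Data.Nat using (ℕ; zero; suc; _+_; _*_; _∸_; _≤_; _/_; NonZero)
open import Data.Product using (Σ; ∃; _×_)
open import Data.List using (List; length)
open import Data.List.Membership.Propositional using (_∈_)
open import Data.List.Relation.Unary.Unique.Propositional using (Unique)
open import Relation.Nullary using (¬_)
open import Relation.Binary.PropositionalEquality using (_≡_; _≢_)
open import Function.Bundles using (_⇔_)

-- x ∈ ⟨ n , n+1 , … , n+t ⟩ : ℕ-linear combinations of the generators,
-- built by adding one generator n + i (0 ≤ i ≤ t) at a time.
data InS (n t : ℕ) : ℕ → Set where
  s-zero : InS n t 0
  s-add  : ∀ {x} i → i ≤ t → InS n t x → InS n t (n + i + x)

InQS*+S : (n t q : ℕ) → ℕ → Set
InQS*+S n t q x = ∃ λ a → ∃ λ b → InS n t a × a ≢ 0 × InS n t b × x ≡ q * a + b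

InGM : (n t q : ℕ) → ℕ → Set
InGM n t q x = InS n t x × ¬ InQS*+S n t q x

HasCard : (ℕ → Set) → ℕ → Set
HasCard P k = Σ (List ℕ) λ xs → Unique xs × (∀ x → (x ∈ xs) ⇔ P x) × length xs ≡ k

-- GM_q(S) = g  means  #(S ∖ (qS* + S)) + 1 = g
GMIs : (n t q : ℕ) → ℕ → Set
GMIs n t q g = ∃ λ k → HasCard (InGM n t q) k × suc k ≡ g

ceilDiv : (m q : ℕ) → .{{NonZero q}} → ℕ
ceilDiv m q = (m + (q ∸ 1)) / q

-- Because t ≥ (n − 1)/2, the consecutive blocks [kn, k(n+t)] overlap from k = 2 on, so
-- S = {0} ∪ [n, n+t] ∪ [2n, ∞).  Every element of qS* + S is at least qn, and all of
-- [qn + 2n, ∞) lies in it, so S ∖ (qS* + S) consists of the t + 2 + (q − 2)n elements of S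
-- below qn together with those qn + y (y < 2n) for which y is not of the form qj + b with
-- j ≤ t and b ∈ {0} ∪ [n, n+t].  Hence GM_q(S) + #C = qn + t + 3, where C is the set of
-- y < 2n that are of this form; in each of the three ranges of q, C is an explicit union
-- of an arithmetic progression, a few points and intervals, and counting it gives the formula.
module Submission where

open import Defs
open import Data.Nat using (ℕ; _+_; _*_; _∸_; _≤_; _<_; _/_; _⊔_; _⊓_; NonZero)
open import Data.Integer using (ℤ; +_; _-_) renaming (_+_ to _+ℤ_)
open import Relation.Binary.PropositionalEquality using (_≡_; _≢_)
open import Data.Product using (_×_; ∃)

open import Data.Bool using (true; false; if_then_else_)
open import Data.Empty using (⊥-elim)
open import Data.Integer.Properties using (pos-+)
open import Data.Integer.Tactic.RingSolver using () renaming (solve-∀ to solve-∀ℤ)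
open import Data.List using ([_]; _++_; length; filter; upTo)
open import Data.List.Membership.Propositional using (_∈_)
open import Data.List.Membership.Propositional.Properties using (∈-filter⁺; ∈-filter⁻; ∈-upTo⁺; ∈-upTo⁻)
open import Data.List.Properties using (filter-++; length-++; upTo-∷ʳ)
open import Data.List.Relation.Unary.Unique.Propositional.Properties using (filter⁺; upTo⁺)
open import Data.Nat using (zero; suc; z≤n; s≤s; _≤?_; _<?_; _≟_; >-nonZero⁻¹)
open import Data.Nat.DivMod
  using (_%_; m≡m%n+[m/n]*n; m%n<n; m/n*n≤m; m*n/n≡m; /-monoˡ-≤; m<n*o⇒m/o<n; m<n⇒m/n≡0; n/n≡1; +-distrib-/-∣ʳ)
open import Data.Nat.Divisibility using (_∣_; divides; _∣?_; ∣-refl; _∣0; >⇒∤; ∣m+n∣m⇒∣n; ∣m∣n⇒∣m+n)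
open import Data.Nat.Induction using (<-rec)
open import Data.Nat.Properties
open import Algebra.Properties.CommutativeSemigroup +-commutativeSemigroup using (interchange)
open import Data.Nat.Tactic.RingSolver using (solve-∀)
open import Data.Product using (_,_; proj₁; proj₂)
open import Data.Sum using (_⊎_; inj₁; inj₂; [_,_]′)
open import Function using (_∘_; id)
open import Function.Bundles using (_⇔_; mk⇔; Equivalence)
open import Function.Properties.Equivalence using () renaming (trans to ⇔-trans; sym to ⇔-sym)
open import Relation.Binary.PropositionalEquality using (refl; sym; trans; cong; cong₂; subst; subst₂; module ≡-Reasoning)
open import Relation.Nullary using (¬_; Dec; yes; no; does)
open import Relation.Nullary.Decidable using (does-⇔; _⊎-dec_; _×-dec_; ¬?)
open import Relation.Unary using (Decidable)

open Equivalence using (to; from)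

indicator : {A : Set} → Dec A → ℕ
indicator a? = if does a? then 1 else 0

indicator-yes : {A : Set} (a? : Dec A) → A → indicator a? ≡ 1
indicator-yes (yes _) _ = refl
indicator-yes (no ¬a) a = ⊥-elim (¬a a)

indicator-no : {A : Set} (a? : Dec A) → ¬ A → indicator a? ≡ 0
indicator-no (yes a) ¬a = ⊥-elim (¬a a)
indicator-no (no _) _ = refl

indicator-⇔ : {A B : Set} (a? : Dec A) (b? : Dec B) → A ⇔ B → indicator a? ≡ indicator b?
indicator-⇔ a? b? A⇔B = cong (λ b → if b then 1 else 0) (does-⇔ A⇔B a? b?)

indicator-⊎ : {A B : Set} (a? : Dec A) (b? : Dec B) → (A → ¬ B) → indicator (a? ⊎-dec b?) ≡ indicator a? + indicator b?
indicator-⊎ (yes a) (yes b) a#b = ⊥-elim (a#b a b)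
indicator-⊎ (yes _) (no _)  _   = refl
indicator-⊎ (no _)  (yes _) _   = refl
indicator-⊎ (no _)  (no _)  _   = refl

count : {P : ℕ → Set} → Decidable P → ℕ → ℕ
count P? m = length (filter P? (upTo m))

count-suc : {P : ℕ → Set} (P? : Decidable P) → ∀ m → count P? (suc m) ≡ count P? m + indicator (P? m)
count-suc P? m = begin
  length (filter P? (upTo (suc m)))
    ≡⟨ cong (length ∘ filter P?) (upTo-∷ʳ m) ⟨
  length (filter P? (upTo m ++ [ m ]))
    ≡⟨ cong length (filter-++ P? (upTo m) [ m ]) ⟩
  length (filter P? (upTo m) ++ filter P? [ m ])
    ≡⟨ length-++ (filter P? (upTo m)) ⟩
  count P? m + length (filter P? [ m ])
    ≡⟨ cong (λ k → count P? m + k) singleton ⟩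
  count P? m + indicator (P? m) ∎
  where
  open ≡-Reasoning
  singleton : length (filter P? [ m ]) ≡ indicator (P? m)
  singleton with does (P? m)
  ... | true  = refl
  ... | false = refl

module _ {P : ℕ → Set} (P? : Decidable P) where

  count-+ : ∀ a m → count P? (a + m) ≡ count P? a + count (λ y → P? (a + y)) m
  count-+ a zero = trans (cong (count P?) (+-identityʳ a)) (sym (+-identityʳ _))
  count-+ a (suc m) = begin
    count P? (a + suc m)
      ≡⟨ cong (count P?) (+-suc a m) ⟩
    count P? (suc (a + m))
      ≡⟨ count-suc P? (a + m) ⟩
    count P? (a + m) + indicator (P? (a + m))
      ≡⟨ cong (_+ indicator (P? (a + m))) (count-+ a m) ⟩
    count P? a + count (λ y → P? (a + y)) m + indicator (P? (a + m))
      ≡⟨ +-assoc (count P? a) _ _ ⟩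
    count P? a + (count (λ y → P? (a + y)) m + indicator (P? (a + m)))
      ≡⟨ cong (λ k → count P? a + k) (count-suc _ m) ⟨
    count P? a + count (λ y → P? (a + y)) (suc m) ∎
    where open ≡-Reasoning

  count-full : ∀ m → (∀ y → y < m → P y) → count P? m ≡ m
  count-full zero _ = refl
  count-full (suc m) all = begin
    count P? (suc m)
      ≡⟨ count-suc P? m ⟩
    count P? m + indicator (P? m)
      ≡⟨ cong₂ _+_ (count-full m (λ y y<m → all y (m<n⇒m<1+n y<m))) (indicator-yes (P? m) (all m ≤-refl)) ⟩
    m + 1
      ≡⟨ +-comm m 1 ⟩
    suc m ∎
    where open ≡-Reasoning

  count-empty : ∀ m → (∀ y → y < m → ¬ P y) → count P? m ≡ 0
  count-empty zero _ = refl
  count-empty (suc m) none = begin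
    count P? (suc m)
      ≡⟨ count-suc P? m ⟩
    count P? m + indicator (P? m)
      ≡⟨ cong₂ _+_ (count-empty m (λ y y<m → none y (m<n⇒m<1+n y<m))) (indicator-no (P? m) (none m ≤-refl)) ⟩
    0 ∎
    where open ≡-Reasoning

module _ {P Q : ℕ → Set} (P? : Decidable P) (Q? : Decidable Q) where

  count-cong : ∀ m → (∀ y → y < m → P y ⇔ Q y) → count P? m ≡ count Q? m
  count-cong zero _ = refl
  count-cong (suc m) P⇔Q = begin
    count P? (suc m)
      ≡⟨ count-suc P? m ⟩
    count P? m + indicator (P? m)
      ≡⟨ cong₂ _+_ (count-cong m (λ y y<m → P⇔Q y (m<n⇒m<1+n y<m)))
                   (indicator-⇔ (P? m) (Q? m) (P⇔Q m ≤-refl)) ⟩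
    count Q? m + indicator (Q? m)
      ≡⟨ count-suc Q? m ⟨
    count Q? (suc m) ∎
    where open ≡-Reasoning

  count-⊎ : ∀ m → (∀ y → y < m → P y → ¬ Q y) → count (λ y → P? y ⊎-dec Q? y) m ≡ count P? m + count Q? m
  count-⊎ zero _ = refl
  count-⊎ (suc m) disjoint = begin
    count P⊎Q? (suc m)
      ≡⟨ count-suc P⊎Q? m ⟩
    count P⊎Q? m + indicator (P⊎Q? m)
      ≡⟨ cong₂ _+_ (count-⊎ m (λ y y<m → disjoint y (m<n⇒m<1+n y<m)))
         (indicator-⊎ (P? m) (Q? m) (disjoint m ≤-refl)) ⟩
    (count P? m + count Q? m) + (indicator (P? m) + indicator (Q? m))
      ≡⟨ interchange (count P? m) _ _ _ ⟩
    (count P? m + indicator (P? m)) + (count Q? m + indicator (Q? m))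
      ≡⟨ cong₂ _+_ (count-suc P? m) (count-suc Q? m) ⟨
    count P? (suc m) + count Q? (suc m) ∎
    where
    open ≡-Reasoning
    P⊎Q? : Decidable (λ y → P y ⊎ Q y)
    P⊎Q? y = P? y ⊎-dec Q? y

count-⊎-absorbˡ : {P Q : ℕ → Set} (P? : Decidable P) (Q? : Decidable Q) →
                  ∀ m → (∀ y → y < m → P y → Q y) → count (λ y → P? y ⊎-dec Q? y) m ≡ count Q? m
count-⊎-absorbˡ P? Q? m P⊆Q = count-cong (λ y → P? y ⊎-dec Q? y) Q? m λ y y<m → mk⇔ [ P⊆Q y y<m , id ]′ inj₂

count-complement : {P : ℕ → Set} (P? : Decidable P) → ∀ m → count (¬? ∘ P?) m + count P? m ≡ m
count-complement P? m = begin
  count (¬? ∘ P?) m + count P? m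
    ≡⟨ count-⊎ (¬? ∘ P?) P? m (λ _ _ ¬p p → ¬p p) ⟨
  count (λ y → ¬? (P? y) ⊎-dec P? y) m
    ≡⟨ count-full _ m (λ y _ → excluded-middle (P? y)) ⟩
  m ∎
  where
  open ≡-Reasoning
  excluded-middle : {A : Set} → Dec A → ¬ A ⊎ A
  excluded-middle (yes a) = inj₂ a
  excluded-middle (no ¬a) = inj₁ ¬a

count-window : {P : ℕ → Set} (P? : Decidable P) → ∀ {a b m} → a ≤ b → b ≤ m →
               (∀ y → y < m → P y ⇔ (a ≤ y × y < b)) → count P? m ≡ b ∸ a
count-window {P} P? {a} {b} {m} a≤b b≤m P⇔window = begin
  count P? m
    ≡⟨ cong (count P?) a+k+r≡m ⟨
  count P? (a + (k + r))
    ≡⟨ count-+ P? a (k + r) ⟩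
  count P? a + count (λ y → P? (a + y)) (k + r)
    ≡⟨ cong₂ _+_ (count-empty P? a below) (count-+ _ k r) ⟩
  count (λ y → P? (a + y)) k + count (λ y → P? (a + (k + y))) r
    ≡⟨ cong₂ _+_ (count-full _ k inside) (count-empty _ r above) ⟩
  k + 0
    ≡⟨ +-identityʳ k ⟩
  b ∸ a ∎
  where
  open ≡-Reasoning
  k r : ℕ
  k = b ∸ a
  r = m ∸ b
  a+k≡b : a + k ≡ b
  a+k≡b = m+[n∸m]≡n a≤b
  a+k+r≡m : a + (k + r) ≡ m
  a+k+r≡m = trans (sym (+-assoc a k r)) (trans (cong (_+ r) a+k≡b) (m+[n∸m]≡n b≤m))
  below : ∀ y → y < a → ¬ P y
  below y y<a py = <⇒≱ y<a (proj₁ (to (P⇔window y (<-≤-trans y<a (≤-trans a≤b b≤m))) py))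
  inside : ∀ y → y < k → P (a + y)
  inside y y<k = from (P⇔window (a + y) (<-≤-trans a+y<b b≤m)) (m≤m+n a y , a+y<b)
    where
    a+y<b : a + y < b
    a+y<b = subst (a + y <_) a+k≡b (+-monoʳ-< a y<k)
  above : ∀ y → y < r → ¬ P (a + (k + y))
  above y y<r py = <⇒≱ (proj₂ (to (P⇔window _ a+k+y<m) py)) (subst (b ≤_) (sym a+k+y≡b+y) (m≤m+n b y))
    where
    a+k+y≡b+y : a + (k + y) ≡ b + y
    a+k+y≡b+y = trans (sym (+-assoc a k y)) (cong (_+ y) a+k≡b)
    a+k+y<m : a + (k + y) < m
    a+k+y<m = subst (_< m) (sym a+k+y≡b+y) (subst (b + y <_) (m+[n∸m]≡n b≤m) (+-monoʳ-< b y<r))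

count-≡ : ∀ {x m} → x < m → count (_≟ x) m ≡ 1
count-≡ {x} x<m = trans (count-window (_≟ x) (n≤1+n x) x<m (λ y _ → singleton y)) (m+n∸n≡m 1 x)
  where
  singleton : ∀ y → y ≡ x ⇔ (x ≤ y × y < suc x)
  singleton y = mk⇔ (λ { refl → ≤-refl , ≤-refl }) (λ (x≤y , y<1+x) → ≤-antisym (≤-pred y<1+x) x≤y)

count-≥ : ∀ {a m} → a ≤ m → count (a ≤?_) m ≡ m ∸ a
count-≥ {a} a≤m = count-window (a ≤?_) a≤m ≤-refl (λ y y<m → mk⇔ (_, y<m) proj₁)

_∈[_,_] : ℕ → ℕ → ℕ → Set
y ∈[ a , b ] = a ≤ y × y ≤ b

_∈[_,_]? : ∀ y a b → Dec (y ∈[ a , b ])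
y ∈[ a , b ]? = (a ≤? y) ×-dec (y ≤? b)

count-∈[] : ∀ {a b m} → a ≤ suc b → b < m → count (_∈[ a , b ]?) m ≡ suc b ∸ a
count-∈[] {a} {b} a≤1+b b<m = count-window (_∈[ a , b ]?) a≤1+b b<m
  (λ y _ → mk⇔ (λ (a≤y , y≤b) → a≤y , s≤s y≤b) (λ (a≤y , y<1+b) → a≤y , ≤-pred y<1+b))

count-HasCard : {P Q : ℕ → Set} (Q? : Decidable Q) → ∀ B →
                (∀ x → P x → x < B) → (∀ x → x < B → P x ⇔ Q x) → HasCard P (count Q? B)
count-HasCard {P} Q? B bounded P⇔Q =
  filter Q? (upTo B) , filter⁺ Q? (upTo⁺ B) , (λ x → mk⇔ (listed⇒P x) (P⇒listed x)) , refl
  where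
  listed⇒P : ∀ x → x ∈ filter Q? (upTo B) → P x
  listed⇒P x x∈ with ∈-filter⁻ Q? x∈
  ... | x∈upTo , qx = from (P⇔Q x (∈-upTo⁻ x∈upTo)) qx
  P⇒listed : ∀ x → P x → x ∈ filter Q? (upTo B)
  P⇒listed x px = ∈-filter⁺ Q? (∈-upTo⁺ (bounded x px)) (to (P⇔Q x (bounded x px)) px)

2*n≡n+n : ∀ n → 2 * n ≡ n + n
2*n≡n+n n = cong (_+_ n) (+-identityʳ n)

[q∸1]*n+n≡q*n : ∀ q n → 1 ≤ q → (q ∸ 1) * n + n ≡ q * n
[q∸1]*n+n≡q*n (suc p) n _ = +-comm (p * n) n

/-unique : ∀ {m k q} .{{_ : NonZero q}} → k * q ≤ m → m < suc k * q → m / q ≡ k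
/-unique {m} {k} {q} kq≤m m<[1+k]q =
  ≤-antisym (≤-pred (m<n*o⇒m/o<n m<[1+k]q)) (subst (_≤ m / q) (m*n/n≡m k q) (/-monoˡ-≤ q kq≤m))

ceilDiv-suc : ∀ m q .{{_ : NonZero q}} → ceilDiv (suc m) q ≡ suc (m / q)
ceilDiv-suc m (suc p) = begin
  (suc m + p) / suc p
    ≡⟨ cong (_/ suc p) (+-suc m p) ⟨
  (m + suc p) / suc p
    ≡⟨ +-distrib-/-∣ʳ m ∣-refl ⟩
  m / suc p + suc p / suc p
    ≡⟨ cong (_+_ (m / suc p)) (n/n≡1 (suc p)) ⟩
  m / suc p + 1
    ≡⟨ +-comm (m / suc p) 1 ⟩
  suc (m / suc p) ∎
  where open ≡-Reasoning

ceilDiv-unique : ∀ {m k q} .{{_ : NonZero q}} → k * q < m → m ≤ suc k * q → ceilDiv m q ≡ suc k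
ceilDiv-unique {suc m} {k} {q} kq<1+m 1+m≤[1+k]q = trans (ceilDiv-suc m q) (cong suc (/-unique (≤-pred kq<1+m) 1+m≤[1+k]q))

⌈n∸1/2⌉≤t⇒n≤1+2t : ∀ {n t} → 1 ≤ n → ceilDiv (n ∸ 1) 2 ≤ t → n ≤ suc (2 * t)
⌈n∸1/2⌉≤t⇒n≤1+2t {n} {t} 1≤n ⌈n∸1/2⌉≤t = begin
  n
    ≡⟨ m≡m%n+[m/n]*n n 2 ⟩
  n % 2 + n / 2 * 2
    ≤⟨ +-mono-≤ (≤-pred (m%n<n n 2)) (*-monoˡ-≤ 2 n/2≤t) ⟩
  1 + t * 2
    ≡⟨ cong suc (*-comm t 2) ⟩
  suc (2 * t) ∎
  where
  open ≤-Reasoning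
  n/2≤t : n / 2 ≤ t
  n/2≤t = subst (λ k → k / 2 ≤ t) (m∸n+n≡m 1≤n) ⌈n∸1/2⌉≤t

module _ {q : ℕ} .{{_ : NonZero q}} where

  count-∣-≤q : ∀ {r} → 1 ≤ r → r ≤ q → count (q ∣?_) r ≡ 1
  count-∣-≤q {r} 1≤r r≤q = count-window (q ∣?_) z≤n 1≤r only-zero
    where
    only-zero : ∀ y → y < r → q ∣ y ⇔ (0 ≤ y × y < 1)
    only-zero zero _ = mk⇔ (λ _ → z≤n , s≤s z≤n) (λ _ → q ∣0)
    only-zero (suc y) 1+y<r = mk⇔ (λ q∣1+y → ⊥-elim (>⇒∤ (<-≤-trans 1+y<r r≤q) q∣1+y)) (λ { (_ , s≤s ()) })

  count-∣-blocks : ∀ k r → count (q ∣?_) (k * q + r) ≡ k + count (q ∣?_) r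
  count-∣-blocks zero r = refl
  count-∣-blocks (suc k) r = begin
    count (q ∣?_) (q + k * q + r)
      ≡⟨ cong (count (q ∣?_)) (+-assoc q (k * q) r) ⟩
    count (q ∣?_) (q + (k * q + r))
      ≡⟨ count-+ (q ∣?_) q (k * q + r) ⟩
    count (q ∣?_) q + count (λ y → q ∣? (q + y)) (k * q + r)
      ≡⟨ cong₂ _+_ (count-∣-≤q (>-nonZero⁻¹ q) ≤-refl)
         (count-cong _ (q ∣?_) (k * q + r) (λ y _ → shift y)) ⟩
    1 + count (q ∣?_) (k * q + r)
      ≡⟨ cong suc (count-∣-blocks k r) ⟩
    suc k + count (q ∣?_) r ∎
    where
    open ≡-Reasoning
    shift : ∀ y → q ∣ q + y ⇔ q ∣ y
    shift y = mk⇔ (λ q∣q+y → ∣m+n∣m⇒∣n q∣q+y ∣-refl) (∣m∣n⇒∣m+n ∣-refl)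

  count-∣ : ∀ m → count (q ∣?_) m ≡ ceilDiv m q
  count-∣ zero = sym (m<n⇒m/n≡0 (∸-monoʳ-< {q} {1} {0} (s≤s z≤n) (>-nonZero⁻¹ q)))
  count-∣ (suc m) = begin
    count (q ∣?_) (suc m)
      ≡⟨ cong (count (q ∣?_)) 1+m≡ ⟩
    count (q ∣?_) (m / q * q + suc (m % q))
      ≡⟨ count-∣-blocks (m / q) (suc (m % q)) ⟩
    m / q + count (q ∣?_) (suc (m % q))
      ≡⟨ cong (_+_ (m / q)) (count-∣-≤q (s≤s z≤n) (m%n<n m q)) ⟩
    m / q + 1
      ≡⟨ +-comm (m / q) 1 ⟩
    suc (m / q)
      ≡⟨ ceilDiv-suc m q ⟨
    ceilDiv (suc m) q ∎
    where
    open ≡-Reasoning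
    1+m≡ : suc m ≡ m / q * q + suc (m % q)
    1+m≡ = trans (cong suc (trans (m≡m%n+[m/n]*n m q) (+-comm (m % q) _))) (sym (+-suc _ _))

g+b≡a+c⇒g≡a-b+c : ∀ {g a b c} → g + b ≡ a + c → + g ≡ + a - + b +ℤ + c
g+b≡a+c⇒g≡a-b+c {g} {a} {b} {c} g+b≡a+c = begin
  + g
    ≡⟨ add-sub (+ g) (+ b) ⟩
  (+ g +ℤ + b) - + b
    ≡⟨ cong (_- + b) (pos-+ g b) ⟨
  + (g + b) - + b
    ≡⟨ cong (λ k → + k - + b) g+b≡a+c ⟩
  + (a + c) - + b
    ≡⟨ cong (_- + b) (pos-+ a c) ⟩
  (+ a +ℤ + c) - + b
    ≡⟨ reorder (+ a) (+ b) (+ c) ⟩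
  + a - + b +ℤ + c ∎
  where
  open ≡-Reasoning
  add-sub : ∀ x y → x ≡ (x +ℤ y) - y
  add-sub = solve-∀ℤ
  reorder : ∀ x y z → (x +ℤ z) - y ≡ x - y +ℤ z
  reorder = solve-∀ℤ

g+b+m≡a+c⇒g≡a-b+c-m : ∀ {g a b c m} → g + b + m ≡ a + c → + g ≡ + a - + b +ℤ + c - + m
g+b+m≡a+c⇒g≡a-b+c-m {g} {a} {b} {c} {m} g+b+m≡a+c = begin
  + g
    ≡⟨ g+b≡a+c⇒g≡a-b+c (trans (sym (+-assoc g b m)) g+b+m≡a+c) ⟩
  + a - + (b + m) +ℤ + c
    ≡⟨ cong (λ k → + a - k +ℤ + c) (pos-+ b m) ⟩
  + a - (+ b +ℤ + m) +ℤ + c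
    ≡⟨ reorder (+ a) (+ b) (+ c) (+ m) ⟩
  + a - + b +ℤ + c - + m ∎
  where
  open ≡-Reasoning
  reorder : ∀ x y z w → x - (y +ℤ w) +ℤ z ≡ x - y +ℤ z - w
  reorder = solve-∀ℤ

module _ {n t : ℕ} where

  InS-generator : ∀ {i} → i ≤ t → InS n t (n + i)
  InS-generator {i} i≤t = subst (InS n t) (+-identityʳ (n + i)) (s-add i i≤t s-zero)

  InS-+ : ∀ {a b} → InS n t a → InS n t b → InS n t (a + b)
  InS-+ s-zero sb = sb
  InS-+ {b = b} (s-add {x} i i≤t sx) sb = subst (InS n t) (sym (+-assoc (n + i) x b)) (s-add i i≤t (InS-+ sx sb))

  Shape : ℕ → Set
  Shape x = x ≡ 0 ⊎ x ∈[ n , n + t ] ⊎ 2 * n ≤ x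

  Shape? : Decidable Shape
  Shape? x = (x ≟ 0) ⊎-dec (x ∈[ n , n + t ]? ⊎-dec (2 * n ≤? x))

  InS⇒Shape : ∀ {x} → InS n t x → Shape x
  InS⇒Shape s-zero = inj₁ refl
  InS⇒Shape (s-add {x} i i≤t sx) with InS⇒Shape sx
  ... | inj₁ refl = inj₂ (inj₁ (≤-trans (m≤m+n n i) (m≤m+n (n + i) 0)
                               , subst (_≤ n + t) (sym (+-identityʳ (n + i))) (+-monoʳ-≤ n i≤t)))
  ... | inj₂ (inj₁ (n≤x , _)) = inj₂ (inj₂ (+-mono-≤ (m≤m+n n i) (subst (_≤ x) (sym (+-identityʳ n)) n≤x)))
  ... | inj₂ (inj₂ 2n≤x) = inj₂ (inj₂ (≤-trans 2n≤x (m≤n+m x (n + i))))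

  module _ (n≤2t+1 : n ≤ suc (2 * t)) (t<n : t < n) where

    1≤n : 1 ≤ n
    1≤n = ≤-trans (s≤s z≤n) t<n

    n≤2n : n ≤ 2 * n
    n≤2n = m≤m+n n (n + 0)

    n+t<2n : n + t < 2 * n
    n+t<2n = subst (n + t <_) (sym (2*n≡n+n n)) (+-monoʳ-< n t<n)

    -- 2n + d is (n + d) + n, (n + t) + (n + (d − t)) or n + (2n + (d − n)), according as
    -- d ≤ t, t < d ≤ 2t, or d > 2t, in which case n ≤ d because n ≤ 2t + 1.
    InS-2n+ : ∀ d → InS n t (2 * n + d)
    InS-2n+ = <-rec (λ d → InS n t (2 * n + d)) step
      where
      step : ∀ d → (∀ {d′} → d′ < d → InS n t (2 * n + d′)) → InS n t (2 * n + d)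
      step d rec with d ≤? t | d ≤? 2 * t
      ... | yes d≤t | _ = subst (InS n t) (regroup n d) (InS-+ (InS-generator d≤t) (InS-generator z≤n))
        where
        regroup : ∀ n d → n + d + (n + 0) ≡ 2 * n + d
        regroup = solve-∀
      ... | no d≰t | yes d≤2t with e , refl ← m≤n⇒∃[o]m+o≡n (<⇒≤ (≰⇒> d≰t)) =
        subst (InS n t) (regroup n t e) (InS-+ (InS-generator ≤-refl) (InS-generator e≤t))
        where
        e≤t : e ≤ t
        e≤t = +-cancelˡ-≤ t e t (subst (t + e ≤_) (cong (_+_ t) (+-identityʳ t)) d≤2t)
        regroup : ∀ n t e → n + t + (n + e) ≡ 2 * n + (t + e)
        regroup = solve-∀
      ... | no _ | no d≰2t with e , refl ← m≤n⇒∃[o]m+o≡n (≤-trans n≤2t+1 (≰⇒> d≰2t)) =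
        subst (InS n t) (regroup n e) (InS-+ (InS-generator z≤n) (rec (m<n+m e 1≤n)))
        where
        regroup : ∀ n e → n + 0 + (2 * n + e) ≡ 2 * n + (n + e)
        regroup = solve-∀

    Shape⇒InS : ∀ {x} → Shape x → InS n t x
    Shape⇒InS (inj₁ refl) = s-zero
    Shape⇒InS (inj₂ (inj₁ (n≤x , x≤n+t))) =
      subst (InS n t) (m+[n∸m]≡n n≤x) (InS-generator (subst (_ ≤_) (m+n∸m≡n n t) (∸-monoˡ-≤ n x≤n+t)))
    Shape⇒InS (inj₂ (inj₂ 2n≤x)) = subst (InS n t) (m+[n∸m]≡n 2n≤x) (InS-2n+ _)

    count-[n,n+t] : ∀ {m} → n + t < m → count (_∈[ n , n + t ]?) m ≡ suc t
    count-[n,n+t] n+t<m = trans (count-∈[] (≤-trans (m≤m+n n t) (n≤1+n _)) n+t<m)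
                                (trans (cong (_∸ n) (sym (+-suc n t))) (m+n∸m≡n n (suc t)))

    count-Shape : ∀ {m} → 2 * n ≤ m → count Shape? m ≡ suc (suc t) + (m ∸ 2 * n)
    count-Shape {m} 2n≤m = begin
      count Shape? m
        ≡⟨ count-⊎ (_≟ 0) _ m zero∉ ⟩
      count (_≟ 0) m + count rest? m
        ≡⟨ cong₂ _+_ (count-≡ (<-≤-trans 1≤n (≤-trans n≤2n 2n≤m))) (count-⊎ _ _ m interval∉) ⟩
      1 + (count (_∈[ n , n + t ]?) m + count (2 * n ≤?_) m)
        ≡⟨ cong₂ (λ a b → 1 + (a + b)) (count-[n,n+t] (<-≤-trans n+t<2n 2n≤m)) (count-≥ 2n≤m) ⟩
      suc (suc t) + (m ∸ 2 * n) ∎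
      where
      open ≡-Reasoning
      rest? : Decidable (λ y → y ∈[ n , n + t ] ⊎ 2 * n ≤ y)
      rest? y = y ∈[ n , n + t ]? ⊎-dec (2 * n ≤? y)
      zero∉ : ∀ y → y < m → y ≡ 0 → ¬ (y ∈[ n , n + t ] ⊎ 2 * n ≤ y)
      zero∉ _ _ refl (inj₁ (n≤0 , _)) = <⇒≱ 1≤n n≤0
      zero∉ _ _ refl (inj₂ 2n≤0) = <⇒≱ 1≤n (≤-trans n≤2n 2n≤0)
      interval∉ : ∀ y → y < m → y ∈[ n , n + t ] → ¬ 2 * n ≤ y
      interval∉ _ _ (_ , y≤n+t) 2n≤y = <⇒≱ (≤-<-trans y≤n+t n+t<2n) 2n≤y

    module _ {q : ℕ} (2≤q : 2 ≤ q) where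

      1≤q : 1 ≤ q
      1≤q = ≤-trans (s≤s z≤n) 2≤q

      2n≤qn : 2 * n ≤ q * n
      2n≤qn = *-monoˡ-≤ n 2≤q

      Base : ℕ → Set
      Base b = b ≡ 0 ⊎ b ∈[ n , n + t ]

      Covered : ℕ → Set
      Covered y = ∃ λ j → ∃ λ b → j ≤ t × Base b × y ≡ q * j + b

      nonzero-InS⇒n≤ : ∀ {a} → InS n t a → a ≢ 0 → n ≤ a
      nonzero-InS⇒n≤ sa a≢0 with InS⇒Shape sa
      ... | inj₁ a≡0 = ⊥-elim (a≢0 a≡0)
      ... | inj₂ (inj₁ (n≤a , _)) = n≤a
      ... | inj₂ (inj₂ 2n≤a) = ≤-trans n≤2n 2n≤a

      InQS*+S⇒qn≤ : ∀ {x} → InQS*+S n t q x → q * n ≤ x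
      InQS*+S⇒qn≤ (a , b , sa , a≢0 , _ , refl) = ≤-trans (*-monoʳ-≤ q (nonzero-InS⇒n≤ sa a≢0)) (m≤m+n (q * a) b)

      InQS*+S-beyond : ∀ {x} → q * n + 2 * n ≤ x → InQS*+S n t q x
      InQS*+S-beyond {x} qn+2n≤x =
        n , x ∸ q * n , n∈S , (λ n≡0 → <⇒≱ 1≤n (≤-reflexive n≡0))
          , Shape⇒InS (inj₂ (inj₂ 2n≤x∸qn)) , sym (m+[n∸m]≡n qn≤x)
        where
        n∈S : InS n t n
        n∈S = subst (InS n t) (+-identityʳ n) (InS-generator z≤n)
        qn≤x : q * n ≤ x
        qn≤x = ≤-trans (m≤m+n (q * n) (2 * n)) qn+2n≤x
        2n≤x∸qn : 2 * n ≤ x ∸ q * n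
        2n≤x∸qn = subst (_≤ x ∸ q * n) (m+n∸m≡n (q * n) (2 * n)) (∸-monoˡ-≤ (q * n) qn+2n≤x)

      InQS*+S-shift : ∀ {y} → y < 2 * n → InQS*+S n t q (q * n + y) ⇔ Covered y
      InQS*+S-shift {y} y<2n = mk⇔ ⇒covered covered⇒
        where
        too-large : ∀ {x} → q * n + 2 * n ≤ x → q * n + y ≢ x
        too-large le refl = <⇒≱ (+-monoʳ-< (q * n) y<2n) le
        covered : ∀ {a b} → a ∈[ n , n + t ] → Base b → q * n + y ≡ q * a + b → Covered y
        covered {a} {b} (n≤a , a≤n+t) base e = a ∸ n , b , a∸n≤t , base , +-cancelˡ-≡ (q * n) y _ (trans e split)
          where
          a∸n≤t : a ∸ n ≤ t
          a∸n≤t = subst (a ∸ n ≤_) (m+n∸m≡n n t) (∸-monoˡ-≤ n a≤n+t)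
          distrib : ∀ q n j b → q * (n + j) + b ≡ q * n + (q * j + b)
          distrib = solve-∀
          split : q * a + b ≡ q * n + (q * (a ∸ n) + b)
          split = trans (cong (λ a → q * a + b) (sym (m+[n∸m]≡n n≤a))) (distrib q n (a ∸ n) b)
        ⇒covered : InQS*+S n t q (q * n + y) → Covered y
        ⇒covered (a , b , sa , a≢0 , sb , e) with InS⇒Shape sa | InS⇒Shape sb
        ... | inj₁ a≡0 | _ = ⊥-elim (a≢0 a≡0)
        ... | inj₂ (inj₂ 2n≤a) | _ = ⊥-elim (too-large qn+2n≤qa+b e)
          where
          distrib : ∀ q n → q * n + q * n ≡ q * (2 * n)
          distrib = solve-∀
          qn+2n≤qa+b : q * n + 2 * n ≤ q * a + b
          qn+2n≤qa+b = ≤-trans (+-monoʳ-≤ (q * n) 2n≤qn)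
                         (≤-trans (≤-reflexive (distrib q n)) (≤-trans (*-monoʳ-≤ q 2n≤a) (m≤m+n (q * a) b)))
        ... | inj₂ (inj₁ (n≤a , _)) | inj₂ (inj₂ 2n≤b) = ⊥-elim (too-large (+-mono-≤ (*-monoʳ-≤ q n≤a) 2n≤b) e)
        ... | inj₂ (inj₁ a∈) | inj₁ b≡0 = covered a∈ (inj₁ b≡0) e
        ... | inj₂ (inj₁ a∈) | inj₂ (inj₁ b∈) = covered a∈ (inj₂ b∈) e
        covered⇒ : Covered y → InQS*+S n t q (q * n + y)
        covered⇒ (j , b , j≤t , base , refl) =
          n + j , b , InS-generator j≤t , n+j≢0 , Shape⇒InS (Base⇒Shape base) , distrib q n j b
          where
          n+j≢0 : n + j ≢ 0
          n+j≢0 e = <⇒≱ 1≤n (subst (n ≤_) e (m≤m+n n j))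
          Base⇒Shape : Base b → Shape b
          Base⇒Shape (inj₁ b≡0) = inj₁ b≡0
          Base⇒Shape (inj₂ b∈) = inj₂ (inj₁ b∈)
          distrib : ∀ q n j b → q * n + (q * j + b) ≡ q * (n + j) + b
          distrib = solve-∀

      InGM-below : ∀ {x} → x < q * n → InGM n t q x ⇔ Shape x
      InGM-below x<qn = mk⇔ (InS⇒Shape ∘ proj₁) (λ sx → Shape⇒InS sx , λ x∈ → <⇒≱ x<qn (InQS*+S⇒qn≤ x∈))

      InGM-shift : ∀ {y} → y < 2 * n → InGM n t q (q * n + y) ⇔ (¬ Covered y)
      InGM-shift {y} y<2n = mk⇔ (λ (_ , ∉) → ∉ ∘ from (InQS*+S-shift y<2n))
                                 (λ ¬cov → Shape⇒InS (inj₂ (inj₂ (≤-trans 2n≤qn (m≤m+n (q * n) y))))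
                                          , ¬cov ∘ to (InQS*+S-shift y<2n))

      InGM⇒<qn+2n : ∀ {x} → InGM n t q x → x < q * n + 2 * n
      InGM⇒<qn+2n {x} (_ , ∉) with x <? q * n + 2 * n
      ... | yes x<qn+2n = x<qn+2n
      ... | no x≮qn+2n = ⊥-elim (∉ (InQS*+S-beyond (≮⇒≥ x≮qn+2n)))

      module _ {C : ℕ → Set} (C? : Decidable C) (Covered⇔C : ∀ y → y < 2 * n → Covered y ⇔ C y) where

        private
          G : ℕ → Set
          G x = (x < q * n × Shape x) ⊎ (q * n ≤ x × ¬ C (x ∸ q * n))

          G? : Decidable G
          G? x = ((x <? q * n) ×-dec Shape? x) ⊎-dec ((q * n ≤? x) ×-dec ¬? (C? (x ∸ q * n)))

          G-below : ∀ y → y < q * n → G y ⇔ Shape y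
          G-below y y<qn = mk⇔ [ proj₂ , (λ (qn≤y , _) → ⊥-elim (<⇒≱ y<qn qn≤y)) ]′ (λ sy → inj₁ (y<qn , sy))

          G-shift : ∀ y → G (q * n + y) ⇔ (¬ C y)
          G-shift y = mk⇔ [ (λ (qn+y<qn , _) → ⊥-elim (<⇒≱ qn+y<qn (m≤m+n (q * n) y)))
                            , (λ (_ , ¬c) → subst (¬_ ∘ C) qn+y∸qn≡y ¬c) ]′
                          (λ ¬c → inj₂ (m≤m+n (q * n) y , subst (¬_ ∘ C) (sym qn+y∸qn≡y) ¬c))
            where
            qn+y∸qn≡y : q * n + y ∸ q * n ≡ y
            qn+y∸qn≡y = m+n∸m≡n (q * n) y

          ¬-cong : ∀ {A B : Set} → A ⇔ B → (¬ A) ⇔ (¬ B)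
          ¬-cong A⇔B = mk⇔ (λ ¬a → ¬a ∘ from A⇔B) (λ ¬b → ¬b ∘ to A⇔B)

          InGM⇔G : ∀ x → x < q * n + 2 * n → InGM n t q x ⇔ G x
          InGM⇔G x x<qn+2n with x <? q * n
          ... | yes x<qn = ⇔-trans (InGM-below x<qn) (⇔-sym (G-below x x<qn))
          ... | no x≮qn with y , refl ← m≤n⇒∃[o]m+o≡n (≮⇒≥ x≮qn) =
            ⇔-trans (InGM-shift y<2n) (⇔-trans (¬-cong (Covered⇔C y y<2n)) (⇔-sym (G-shift y)))
            where
            y<2n : y < 2 * n
            y<2n = +-cancelˡ-< (q * n) y (2 * n) x<qn+2n

          count-G : count G? (q * n + 2 * n) ≡ count Shape? (q * n) + count (¬? ∘ C?) (2 * n)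
          count-G = trans (count-+ G? (q * n) (2 * n))
                          (cong₂ _+_ (count-cong G? Shape? (q * n) G-below)
                                     (count-cong _ (¬? ∘ C?) (2 * n) (λ y _ → G-shift y)))

        GM+count≡qn+t+3 : ∃ λ g → GMIs n t q g × g + count C? (2 * n) ≡ 3 + q * n + t
        GM+count≡qn+t+3 = suc k , (k , count-HasCard G? (q * n + 2 * n) (λ _ → InGM⇒<qn+2n) InGM⇔G , refl) , size
          where
          open ≡-Reasoning
          k : ℕ
          k = count G? (q * n + 2 * n)
          size : suc k + count C? (2 * n) ≡ 3 + q * n + t
          size = begin
            suc k + count C? (2 * n)
              ≡⟨ cong (λ k → suc k + count C? (2 * n)) count-G ⟩
            suc (count Shape? (q * n) + count (¬? ∘ C?) (2 * n) + count C? (2 * n))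
              ≡⟨ cong suc (+-assoc (count Shape? (q * n)) _ _) ⟩
            suc (count Shape? (q * n) + (count (¬? ∘ C?) (2 * n) + count C? (2 * n)))
              ≡⟨ cong₂ (λ a b → suc (a + b)) (count-Shape 2n≤qn)
                 (count-complement C? (2 * n)) ⟩
            suc (suc (suc t) + (q * n ∸ 2 * n) + 2 * n)
              ≡⟨ cong suc (+-assoc (suc (suc t)) _ _) ⟩
            suc (suc (suc t) + (q * n ∸ 2 * n + 2 * n))
              ≡⟨ cong (λ m → suc (suc (suc t) + m)) (m∸n+n≡m 2n≤qn) ⟩
            3 + (t + q * n)
              ≡⟨ cong (_+_ 3) (+-comm t (q * n)) ⟩
            3 + q * n + t ∎

      small-multiplier : ∀ m → m * q < n → m ≤ t
      small-multiplier m mq<n with m ≤? t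
      ... | yes m≤t = m≤t
      ... | no m≰t = ⊥-elim (<⇒≱ mq<n (≤-trans n≤2t+1 (≤-trans (n≤1+n _)
                       (subst (_≤ m * q) (double t) (*-mono-≤ (≰⇒> m≰t) 2≤q)))))
        where
        double : ∀ t → suc t * 2 ≡ suc (suc (2 * t))
        double = solve-∀

      module _ .{{_ : NonZero q}} (q≤t+1 : q ≤ t + 1) where

        C₁ : ℕ → Set
        C₁ y = (y < n × q ∣ y) ⊎ n ≤ y

        C₁? : Decidable C₁
        C₁? y = ((y <? n) ×-dec (q ∣? y)) ⊎-dec (n ≤? y)

        Covered⇔C₁ : ∀ y → y < 2 * n → Covered y ⇔ C₁ y
        Covered⇔C₁ y y<2n = mk⇔ ⇒C₁ C₁⇒
          where
          ⇒C₁ : Covered y → C₁ y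
          ⇒C₁ (j , b , _ , inj₂ (n≤b , _) , refl) = inj₂ (≤-trans n≤b (m≤n+m b (q * j)))
          ⇒C₁ (j , _ , _ , inj₁ refl , refl) with q * j + 0 <? n
          ... | yes qj<n = inj₁ (qj<n , divides j (trans (+-identityʳ (q * j)) (*-comm q j)))
          ... | no qj≮n = inj₂ (≮⇒≥ qj≮n)
          C₁⇒ : C₁ y → Covered y
          C₁⇒ (inj₁ (y<n , divides m refl)) =
            m , 0 , small-multiplier m y<n , inj₁ refl , trans (*-comm m q) (sym (+-identityʳ (q * m)))
          C₁⇒ (inj₂ n≤y) = z / q , n + z % q , z/q≤t , inj₂ (m≤m+n n _ , +-monoʳ-≤ n z%q≤t) , y≡
            where
            z : ℕ
            z = y ∸ n
            z<n : z < n
            z<n = subst (z <_) (trans (cong (_∸ n) (2*n≡n+n n)) (m+n∸m≡n n n)) (∸-monoˡ-< y<2n n≤y)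
            z/q≤t : z / q ≤ t
            z/q≤t = small-multiplier (z / q) (≤-<-trans (m/n*n≤m z q) z<n)
            z%q≤t : z % q ≤ t
            z%q≤t = ≤-pred (≤-trans (m%n<n z q) (subst (q ≤_) (+-comm t 1) q≤t+1))
            reorder : ∀ n r j q → n + (r + j * q) ≡ q * j + (n + r)
            reorder = solve-∀
            y≡ : y ≡ q * (z / q) + (n + z % q)
            y≡ = trans (sym (m+[n∸m]≡n n≤y)) (trans (cong (_+_ n) (m≡m%n+[m/n]*n z q)) (reorder n (z % q) (z / q) q))

        count-C₁ : count C₁? (2 * n) ≡ ceilDiv n q + n
        count-C₁ = begin
          count C₁? (2 * n)
            ≡⟨ cong (count C₁?) (2*n≡n+n n) ⟩
          count C₁? (n + n)
            ≡⟨ count-+ C₁? n n ⟩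
          count C₁? n + count (λ y → C₁? (n + y)) n
            ≡⟨ cong₂ _+_ (count-cong C₁? (q ∣?_) n below) (count-full _ n (λ y _ → inj₂ (m≤m+n n y))) ⟩
          count (q ∣?_) n + n
            ≡⟨ cong (_+ n) (count-∣ n) ⟩
          ceilDiv n q + n ∎
          where
          open ≡-Reasoning
          below : ∀ y → y < n → C₁ y ⇔ q ∣ y
          below y y<n = mk⇔ [ proj₂ , (λ n≤y → ⊥-elim (<⇒≱ y<n n≤y)) ]′ (λ q∣y → inj₁ (y<n , q∣y))

        case₁ : ∃ λ g → GMIs n t q g × (+ g ≡ + (3 + (q ∸ 1) * n) - + (ceilDiv n q) +ℤ + t)
        case₁ with GM+count≡qn+t+3 C₁? Covered⇔C₁
        ... | g , gm , size = g , gm , g+b≡a+c⇒g≡a-b+c (+-cancelʳ-≡ n _ _ (begin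
          g + ceilDiv n q + n
            ≡⟨ +-assoc g _ n ⟩
          g + (ceilDiv n q + n)
            ≡⟨ cong (_+_ g) count-C₁ ⟨
          g + count C₁? (2 * n)
            ≡⟨ size ⟩
          3 + q * n + t
            ≡⟨ cong (λ k → 3 + k + t) ([q∸1]*n+n≡q*n q n 1≤q) ⟨
          3 + ((q ∸ 1) * n + n) + t
            ≡⟨ reorder ((q ∸ 1) * n) n t ⟩
          3 + (q ∸ 1) * n + t + n ∎))
          where
          open ≡-Reasoning
          reorder : ∀ a n t → 3 + (a + n) + t ≡ 3 + a + t + n
          reorder = solve-∀

      module _ .{{_ : NonZero q}} (t+2≤q : t + 2 ≤ q) (q<n : q < n) where

        2≤t : 2 ≤ t
        2≤t = +-cancelˡ-≤ t 2 t (≤-pred (<-≤-trans (≤-<-trans t+2≤q q<n)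
                                                 (≤-trans n≤2t+1 (≤-reflexive (cong suc (2*n≡n+n t))))))

        t<q : t < q
        t<q = ≤-trans (m<m+n t (s≤s z≤n)) t+2≤q

        n<2q : n < 2 * q
        n<2q = ≤-<-trans n≤2t+1 (subst (_≤ 2 * q) (double t) (*-monoʳ-≤ 2 t<q))
          where
          double : ∀ t → 2 * suc t ≡ suc (suc (2 * t))
          double = solve-∀

        q<2q : q < 2 * q
        q<2q = subst (q <_) (sym (2*n≡n+n q)) (m<m+n q 1≤q)

        t+n<3q : t + n < 3 * q
        t+n<3q = +-mono-< t<q n<2q

        C₂ : ℕ → Set
        C₂ y = y ≡ 0 ⊎ y ≡ q ⊎ y ≡ 2 * q ⊎ y ∈[ n , n + t ] ⊎ n + q ≤ y

        [n,n+t]⊎≥n+q? : Decidable (λ y → y ∈[ n , n + t ] ⊎ n + q ≤ y)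
        [n,n+t]⊎≥n+q? y = y ∈[ n , n + t ]? ⊎-dec (n + q ≤? y)

        2q⊎[n,n+t]⊎≥n+q? : Decidable (λ y → y ≡ 2 * q ⊎ y ∈[ n , n + t ] ⊎ n + q ≤ y)
        2q⊎[n,n+t]⊎≥n+q? y = (y ≟ 2 * q) ⊎-dec [n,n+t]⊎≥n+q? y

        C₂? : Decidable C₂
        C₂? y = (y ≟ 0) ⊎-dec ((y ≟ q) ⊎-dec 2q⊎[n,n+t]⊎≥n+q? y)

        Covered⇔C₂ : ∀ y → y < 2 * n → Covered y ⇔ C₂ y
        Covered⇔C₂ y y<2n = mk⇔ ⇒C₂ C₂⇒
          where
          n+q≤q*[1+j]+b : ∀ j {b} → n ≤ b → n + q ≤ q * suc j + b
          n+q≤q*[1+j]+b j {b} n≤b = subst (_≤ q * suc j + b) (+-comm q n)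
            (+-mono-≤ (subst (_≤ q * suc j) (*-identityʳ q) (*-monoʳ-≤ q (s≤s (z≤n {j})))) n≤b)
          n+q≤q*[3+j] : ∀ j → n + q ≤ q * suc (suc (suc j)) + 0
          n+q≤q*[3+j] j = ≤-trans (+-monoˡ-≤ q (<⇒≤ n<2q))
            (≤-trans (≤-reflexive (triple q)) (≤-trans (*-monoʳ-≤ q (s≤s (s≤s (s≤s (z≤n {j}))))) (m≤m+n _ 0)))
            where
            triple : ∀ q → 2 * q + q ≡ q * 3
            triple = solve-∀
          ⇒C₂ : Covered y → C₂ y
          ⇒C₂ (0 , _ , _ , inj₁ refl , refl) = inj₁ (trans (+-identityʳ (q * 0)) (*-zeroʳ q))
          ⇒C₂ (1 , _ , _ , inj₁ refl , refl) = inj₂ (inj₁ (trans (+-identityʳ (q * 1)) (*-identityʳ q)))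
          ⇒C₂ (2 , _ , _ , inj₁ refl , refl) = inj₂ (inj₂ (inj₁ (trans (+-identityʳ (q * 2)) (*-comm q 2))))
          ⇒C₂ (suc (suc (suc j)) , _ , _ , inj₁ refl , refl) = inj₂ (inj₂ (inj₂ (inj₂ (n+q≤q*[3+j] j))))
          ⇒C₂ (0 , b , _ , inj₂ b∈ , refl) = inj₂ (inj₂ (inj₂ (inj₁ (subst (_∈[ n , n + t ]) (cong (_+ b) (sym (*-zeroʳ q))) b∈))))
          ⇒C₂ (suc j , b , _ , inj₂ (n≤b , _) , refl) = inj₂ (inj₂ (inj₂ (inj₂ (n+q≤q*[1+j]+b j n≤b))))
          C₂⇒ : C₂ y → Covered y
          C₂⇒ (inj₁ refl) = 0 , 0 , z≤n , inj₁ refl , sym (trans (+-identityʳ (q * 0)) (*-zeroʳ q))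
          C₂⇒ (inj₂ (inj₁ refl)) = 1 , 0 , ≤-trans (s≤s z≤n) 2≤t , inj₁ refl , sym (trans (+-identityʳ (q * 1)) (*-identityʳ q))
          C₂⇒ (inj₂ (inj₂ (inj₁ refl))) = 2 , 0 , 2≤t , inj₁ refl , sym (trans (+-identityʳ (q * 2)) (*-comm q 2))
          C₂⇒ (inj₂ (inj₂ (inj₂ (inj₁ y∈)))) = 0 , y , z≤n , inj₂ y∈ , cong (_+ y) (sym (*-zeroʳ q))
          C₂⇒ (inj₂ (inj₂ (inj₂ (inj₂ n+q≤y)))) =
            1 , y ∸ q , ≤-trans (s≤s z≤n) 2≤t , inj₂ (n≤y∸q , y∸q≤n+t)
              , sym (trans (cong (_+ (y ∸ q)) (*-identityʳ q)) (m+[n∸m]≡n q≤y))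
            where
            q≤y : q ≤ y
            q≤y = ≤-trans (m≤n+m q n) n+q≤y
            n≤y∸q : n ≤ y ∸ q
            n≤y∸q = subst (_≤ y ∸ q) (m+n∸n≡m n q) (∸-monoˡ-≤ q n+q≤y)
            reorder : ∀ n q t → n + suc (t + q) ≡ suc (q + (n + t))
            reorder = solve-∀
            2n≤1+q+n+t : 2 * n ≤ suc (q + (n + t))
            2n≤1+q+n+t = ≤-trans (+-monoʳ-≤ n (≤-trans (≤-reflexive (+-identityʳ n)) (≤-trans n≤2t+1
                                   (s≤s (+-monoʳ-≤ t (subst (_≤ q) (sym (+-identityʳ t)) (<⇒≤ t<q)))))))
                                 (≤-reflexive (reorder n q t))
            y∸q≤n+t : y ∸ q ≤ n + t
            y∸q≤n+t = m≤n+o⇒m∸n≤o y q (≤-pred (<-≤-trans y<2n 2n≤1+q+n+t))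

        count-[n,n+t]⊎≥n+q : count [n,n+t]⊎≥n+q? (2 * n) ≡ suc t + (n ∸ q)
        count-[n,n+t]⊎≥n+q = begin
          count [n,n+t]⊎≥n+q? (2 * n)
            ≡⟨ count-⊎ _ (n + q ≤?_) (2 * n) disjoint ⟩
          count (_∈[ n , n + t ]?) (2 * n) + count (n + q ≤?_) (2 * n)
            ≡⟨ cong₂ _+_ (count-[n,n+t] n+t<2n) (count-≥ n+q≤2n) ⟩
          suc t + (2 * n ∸ (n + q))
            ≡⟨ cong (λ k → suc t + (k ∸ (n + q))) (2*n≡n+n n) ⟩
          suc t + (n + n ∸ (n + q))
            ≡⟨ cong (_+_ (suc t)) ([m+n]∸[m+o]≡n∸o n n q) ⟩
          suc t + (n ∸ q) ∎
          where
          open ≡-Reasoning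
          disjoint : ∀ y → y < 2 * n → y ∈[ n , n + t ] → ¬ n + q ≤ y
          disjoint y _ (_ , y≤n+t) n+q≤y = <⇒≱ (+-monoʳ-< n t<q) (≤-trans n+q≤y y≤n+t)
          n+q≤2n : n + q ≤ 2 * n
          n+q≤2n = subst (n + q ≤_) (sym (2*n≡n+n n)) (+-monoʳ-≤ n (<⇒≤ q<n))

        count-2q⊎[n,n+t]⊎≥n+q : count 2q⊎[n,n+t]⊎≥n+q? (2 * n) + (t + n) / q ≡ 3 + t + (n ∸ q)
        count-2q⊎[n,n+t]⊎≥n+q with 2 * q ≤? n + t
        ... | yes 2q≤n+t = begin
          count 2q⊎[n,n+t]⊎≥n+q? (2 * n) + (t + n) / q
            ≡⟨ cong₂ _+_ (count-⊎-absorbˡ (_≟ 2 * q) [n,n+t]⊎≥n+q? (2 * n) 2q∈[n,n+t]) floor-2 ⟩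
          count [n,n+t]⊎≥n+q? (2 * n) + 2
            ≡⟨ cong (_+ 2) count-[n,n+t]⊎≥n+q ⟩
          suc t + (n ∸ q) + 2
            ≡⟨ +-comm (suc t + (n ∸ q)) 2 ⟩
          3 + t + (n ∸ q) ∎
          where
          open ≡-Reasoning
          2q∈[n,n+t] : ∀ y → y < 2 * n → y ≡ 2 * q → y ∈[ n , n + t ] ⊎ n + q ≤ y
          2q∈[n,n+t] _ _ refl = inj₁ (<⇒≤ n<2q , 2q≤n+t)
          floor-2 : (t + n) / q ≡ 2
          floor-2 = /-unique (subst (2 * q ≤_) (+-comm n t) 2q≤n+t) t+n<3q
        ... | no 2q≰n+t = begin
          count 2q⊎[n,n+t]⊎≥n+q? (2 * n) + (t + n) / q
            ≡⟨ cong₂ _+_ (count-⊎ (_≟ 2 * q) [n,n+t]⊎≥n+q? (2 * n) 2q∉) floor-1 ⟩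
          count (_≟ 2 * q) (2 * n) + count [n,n+t]⊎≥n+q? (2 * n) + 1
            ≡⟨ cong₂ (λ a b → a + b + 1) (count-≡ (*-monoʳ-< 2 q<n)) count-[n,n+t]⊎≥n+q ⟩
          1 + (suc t + (n ∸ q)) + 1
            ≡⟨ +-comm (1 + (suc t + (n ∸ q))) 1 ⟩
          3 + t + (n ∸ q) ∎
          where
          open ≡-Reasoning
          2q∉ : ∀ y → y < 2 * n → y ≡ 2 * q → ¬ (y ∈[ n , n + t ] ⊎ n + q ≤ y)
          2q∉ _ _ refl (inj₁ (_ , 2q≤n+t)) = 2q≰n+t 2q≤n+t
          2q∉ _ _ refl (inj₂ n+q≤2q) = <⇒≱ (subst (_< n + q) (sym (2*n≡n+n q)) (+-monoˡ-< q q<n)) n+q≤2q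
          floor-1 : (t + n) / q ≡ 1
          floor-1 = /-unique (subst (_≤ t + n) (sym (*-identityˡ q)) (≤-trans (<⇒≤ q<n) (m≤n+m n t)))
                             (subst (_< 2 * q) (+-comm n t) (≰⇒> 2q≰n+t))

        count-C₂ : count C₂? (2 * n) + (t + n) / q ≡ 5 + t + (n ∸ q)
        count-C₂ = begin
          count C₂? (2 * n) + F
            ≡⟨ cong (_+ F) (count-⊎ (_≟ 0) _ (2 * n) zero∉) ⟩
          count (_≟ 0) (2 * n) + count q⊎upper? (2 * n) + F
            ≡⟨ cong₂ (λ a b → a + b + F) (count-≡ (<-≤-trans 1≤n n≤2n))
               (count-⊎ (_≟ q) _ (2 * n) q∉) ⟩
          1 + (count (_≟ q) (2 * n) + count 2q⊎[n,n+t]⊎≥n+q? (2 * n)) + F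
            ≡⟨ cong (λ a → 1 + (a + count 2q⊎[n,n+t]⊎≥n+q? (2 * n)) + F)
               (count-≡ (<-≤-trans q<n n≤2n)) ⟩
          2 + count 2q⊎[n,n+t]⊎≥n+q? (2 * n) + F
            ≡⟨ +-assoc 2 _ F ⟩
          2 + (count 2q⊎[n,n+t]⊎≥n+q? (2 * n) + F)
            ≡⟨ cong (_+_ 2) count-2q⊎[n,n+t]⊎≥n+q ⟩
          5 + t + (n ∸ q) ∎
          where
          open ≡-Reasoning
          F : ℕ
          F = (t + n) / q
          q⊎upper? : Decidable (λ y → y ≡ q ⊎ y ≡ 2 * q ⊎ y ∈[ n , n + t ] ⊎ n + q ≤ y)
          q⊎upper? y = (y ≟ q) ⊎-dec 2q⊎[n,n+t]⊎≥n+q? y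
          zero∉ : ∀ y → y < 2 * n → y ≡ 0 → ¬ (y ≡ q ⊎ y ≡ 2 * q ⊎ y ∈[ n , n + t ] ⊎ n + q ≤ y)
          zero∉ _ _ refl (inj₁ 0≡q) = <⇒≱ 1≤q (≤-reflexive (sym 0≡q))
          zero∉ _ _ refl (inj₂ (inj₁ 0≡2q)) = <⇒≱ (<-trans 1≤q q<2q) (≤-reflexive (sym 0≡2q))
          zero∉ _ _ refl (inj₂ (inj₂ (inj₁ (n≤0 , _)))) = <⇒≱ 1≤n n≤0
          zero∉ _ _ refl (inj₂ (inj₂ (inj₂ n+q≤0))) = <⇒≱ 1≤n (≤-trans (m≤m+n n q) n+q≤0)
          q∉ : ∀ y → y < 2 * n → y ≡ q → ¬ (y ≡ 2 * q ⊎ y ∈[ n , n + t ] ⊎ n + q ≤ y)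
          q∉ _ _ refl (inj₁ q≡2q) = <⇒≢ q<2q q≡2q
          q∉ _ _ refl (inj₂ (inj₁ (n≤q , _))) = <⇒≱ q<n n≤q
          q∉ _ _ refl (inj₂ (inj₂ n+q≤q)) = <⇒≱ (m<n+m q 1≤n) n+q≤q

        case₂ : ∃ λ g → GMIs n t q g × (+ g ≡ + (4 + (q ∸ 1) * n + q) - + (2 * ceilDiv n q) +ℤ + ((t + n) / q)
                                                - + (((t + n) / q) ⊔ ((1 + n / q) ⊓ t)))
        case₂ with GM+count≡qn+t+3 C₂? Covered⇔C₂
        ... | g , gm , size = g , gm , g+b+m≡a+c⇒g≡a-b+c-m (+-cancelʳ-≡ (t + D) _ _ (begin
          g + 2 * ceilDiv n q + M + (t + D)
            ≡⟨ cong₂ (λ c m → g + 2 * c + m + (t + D)) ceil-2 max-2 ⟩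
          g + 2 * 2 + 2 + (t + D)
            ≡⟨ shuffle₁ g t D ⟩
          suc (g + (5 + t + D))
            ≡⟨ cong (λ k → suc (g + k)) count-C₂ ⟨
          suc (g + (count C₂? (2 * n) + F))
            ≡⟨ cong suc (+-assoc g _ _) ⟨
          suc (g + count C₂? (2 * n) + F)
            ≡⟨ cong (λ k → suc (k + F)) size ⟩
          suc (3 + q * n + t + F)
            ≡⟨ cong (λ k → suc (3 + k + t + F)) qn≡ ⟨
          suc (3 + ((q ∸ 1) * n + (D + q)) + t + F)
            ≡⟨ shuffle₂ ((q ∸ 1) * n) D q t F ⟩
          4 + (q ∸ 1) * n + q + F + (t + D) ∎))
          where
          open ≡-Reasoning
          F M D : ℕ
          F = (t + n) / q
          M = F ⊔ ((1 + n / q) ⊓ t)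
          D = n ∸ q
          ceil-2 : ceilDiv n q ≡ 2
          ceil-2 = ceilDiv-unique (subst (_< n) (sym (*-identityˡ q)) q<n) (<⇒≤ n<2q)
          max-2 : M ≡ 2
          max-2 = begin
            F ⊔ ((1 + n / q) ⊓ t)
              ≡⟨ cong (λ k → F ⊔ ((1 + k) ⊓ t)) (/-unique (subst (_≤ n) (sym (*-identityˡ q)) (<⇒≤ q<n)) n<2q) ⟩
            F ⊔ (2 ⊓ t)
              ≡⟨ cong (F ⊔_) (m≤n⇒m⊓n≡m 2≤t) ⟩
            F ⊔ 2
              ≡⟨ m≤n⇒m⊔n≡n (≤-pred (m<n*o⇒m/o<n t+n<3q)) ⟩
            2 ∎
          qn≡ : (q ∸ 1) * n + (D + q) ≡ q * n
          qn≡ = trans (cong (_+_ ((q ∸ 1) * n)) (m∸n+n≡m (<⇒≤ q<n))) ([q∸1]*n+n≡q*n q n 1≤q)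
          shuffle₁ : ∀ g t d → g + 2 * 2 + 2 + (t + d) ≡ suc (g + (5 + t + d))
          shuffle₁ = solve-∀
          shuffle₂ : ∀ a d q t f → suc (3 + (a + (d + q)) + t + f) ≡ 4 + a + q + f + (t + d)
          shuffle₂ = solve-∀

      module _ .{{_ : NonZero q}} (n≤q : n ≤ q) where

        q⊎[n,n+t]? : Decidable (λ y → y ≡ q ⊎ y ∈[ n , n + t ])
        q⊎[n,n+t]? y = (y ≟ q) ⊎-dec (y ∈[ n , n + t ]?)

        C₃ : ℕ → Set
        C₃ y = y ≡ 0 ⊎ y ≡ q ⊎ y ∈[ n , n + t ]

        C₃? : Decidable C₃
        C₃? y = (y ≟ 0) ⊎-dec q⊎[n,n+t]? y

        Covered⇔C₃ : ∀ y → y < 2 * n → Covered y ⇔ C₃ y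
        Covered⇔C₃ y y<2n = mk⇔ ⇒C₃ C₃⇒
          where
          2n≤2q : 2 * n ≤ q * 2
          2n≤2q = subst (2 * n ≤_) (*-comm 2 q) (*-monoʳ-≤ 2 n≤q)
          ⇒C₃ : Covered y → C₃ y
          ⇒C₃ (0 , _ , _ , inj₁ refl , refl) = inj₁ (trans (+-identityʳ (q * 0)) (*-zeroʳ q))
          ⇒C₃ (0 , b , _ , inj₂ b∈ , refl) = inj₂ (inj₂ (subst (_∈[ n , n + t ]) (cong (_+ b) (sym (*-zeroʳ q))) b∈))
          ⇒C₃ (1 , _ , _ , inj₁ refl , refl) = inj₂ (inj₁ (trans (+-identityʳ (q * 1)) (*-identityʳ q)))
          ⇒C₃ (suc (suc j) , _ , _ , inj₁ refl , refl) =
            ⊥-elim (<⇒≱ y<2n (≤-trans 2n≤2q (≤-trans (*-monoʳ-≤ q (s≤s (s≤s (z≤n {j})))) (m≤m+n _ 0))))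
          ⇒C₃ (suc j , b , _ , inj₂ (n≤b , _) , refl) =
            ⊥-elim (<⇒≱ y<2n (subst (_≤ q * suc j + b) (sym (2*n≡n+n n))
                               (+-mono-≤ (≤-trans n≤q (subst (_≤ q * suc j) (*-identityʳ q) (*-monoʳ-≤ q (s≤s z≤n)))) n≤b)))
          1≤t : q < 2 * n → 1 ≤ t
          1≤t q<2n with 1 ≤? t
          ... | yes 1≤t = 1≤t
          ... | no 1≰t = ⊥-elim (<⇒≱ q<2n (≤-trans (*-monoʳ-≤ 2 n≤1) 2≤q))
            where
            n≤1 : n ≤ 1
            n≤1 = ≤-trans n≤2t+1 (s≤s (*-monoʳ-≤ 2 (≤-pred (≰⇒> 1≰t))))
          C₃⇒ : C₃ y → Covered y
          C₃⇒ (inj₁ refl) = 0 , 0 , z≤n , inj₁ refl , sym (trans (+-identityʳ (q * 0)) (*-zeroʳ q))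
          C₃⇒ (inj₂ (inj₁ refl)) = 1 , 0 , 1≤t y<2n , inj₁ refl , sym (trans (+-identityʳ (q * 1)) (*-identityʳ q))
          C₃⇒ (inj₂ (inj₂ y∈)) = 0 , y , z≤n , inj₂ y∈ , cong (_+ y) (sym (*-zeroʳ q))

        ⌈2n/q⌉≡2 : q < 2 * n → ceilDiv (2 * n) q ≡ 2
        ⌈2n/q⌉≡2 q<2n = ceilDiv-unique (subst (_< 2 * n) (sym (*-identityˡ q)) q<2n) (*-monoʳ-≤ 2 n≤q)

        ⌈2n/q⌉≡1 : 2 * n ≤ q → ceilDiv (2 * n) q ≡ 1
        ⌈2n/q⌉≡1 2n≤q = ceilDiv-unique (<-≤-trans 1≤n n≤2n) (subst (2 * n ≤_) (sym (*-identityˡ q)) 2n≤q)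

        ⌊t+n/q⌋≡0 : n + t < q → (t + n) / q ≡ 0
        ⌊t+n/q⌋≡0 n+t<q = m<n⇒m/n≡0 (subst (_< q) (+-comm n t) n+t<q)

        count-q⊎[n,n+t] : count q⊎[n,n+t]? (2 * n) + (t + n) / q ≡ ceilDiv (2 * n) q + t
        count-q⊎[n,n+t] with q ≤? n + t | q <? 2 * n
        ... | yes q≤n+t | _ = begin
          count q⊎[n,n+t]? (2 * n) + (t + n) / q
            ≡⟨ cong₂ _+_ (count-⊎-absorbˡ (_≟ q) _ (2 * n) q∈[n,n+t]) ⌊t+n/q⌋≡1 ⟩
          count (_∈[ n , n + t ]?) (2 * n) + 1
            ≡⟨ cong (_+ 1) (count-[n,n+t] n+t<2n) ⟩
          suc t + 1
            ≡⟨ +-comm (suc t) 1 ⟩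
          2 + t
            ≡⟨ cong (_+ t) (⌈2n/q⌉≡2 (≤-<-trans q≤n+t n+t<2n)) ⟨
          ceilDiv (2 * n) q + t ∎
          where
          open ≡-Reasoning
          q∈[n,n+t] : ∀ y → y < 2 * n → y ≡ q → y ∈[ n , n + t ]
          q∈[n,n+t] _ _ refl = n≤q , q≤n+t
          ⌊t+n/q⌋≡1 : (t + n) / q ≡ 1
          ⌊t+n/q⌋≡1 = /-unique (subst₂ _≤_ (sym (*-identityˡ q)) (+-comm n t) q≤n+t)
                               (subst (t + n <_) (sym (2*n≡n+n q)) (+-mono-<-≤ (<-≤-trans t<n n≤q) n≤q))
        ... | no q≰n+t | yes q<2n = begin
          count q⊎[n,n+t]? (2 * n) + (t + n) / q
            ≡⟨ cong₂ _+_ (count-⊎ (_≟ q) _ (2 * n) q∉[n,n+t]) (⌊t+n/q⌋≡0 (≰⇒> q≰n+t)) ⟩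
          count (_≟ q) (2 * n) + count (_∈[ n , n + t ]?) (2 * n) + 0
            ≡⟨ cong₂ (λ a b → a + b + 0) (count-≡ q<2n) (count-[n,n+t] n+t<2n) ⟩
          1 + suc t + 0
            ≡⟨ +-identityʳ (2 + t) ⟩
          2 + t
            ≡⟨ cong (_+ t) (⌈2n/q⌉≡2 q<2n) ⟨
          ceilDiv (2 * n) q + t ∎
          where
          open ≡-Reasoning
          q∉[n,n+t] : ∀ y → y < 2 * n → y ≡ q → ¬ y ∈[ n , n + t ]
          q∉[n,n+t] _ _ refl (_ , q≤n+t) = q≰n+t q≤n+t
        ... | no q≰n+t | no q≮2n = begin
          count q⊎[n,n+t]? (2 * n) + (t + n) / q
            ≡⟨ cong₂ _+_ (count-⊎-absorbˡ (_≟ q) _ (2 * n) q-absent) (⌊t+n/q⌋≡0 (≰⇒> q≰n+t)) ⟩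
          count (_∈[ n , n + t ]?) (2 * n) + 0
            ≡⟨ cong (_+ 0) (count-[n,n+t] n+t<2n) ⟩
          suc t + 0
            ≡⟨ +-identityʳ (suc t) ⟩
          1 + t
            ≡⟨ cong (_+ t) (⌈2n/q⌉≡1 (≮⇒≥ q≮2n)) ⟨
          ceilDiv (2 * n) q + t ∎
          where
          open ≡-Reasoning
          q-absent : ∀ y → y < 2 * n → y ≡ q → y ∈[ n , n + t ]
          q-absent _ y<2n refl = ⊥-elim (q≮2n y<2n)

        count-C₃ : count C₃? (2 * n) + (t + n) / q ≡ ceilDiv (2 * n) q + suc t
        count-C₃ = begin
          count C₃? (2 * n) + (t + n) / q
            ≡⟨ cong (_+ (t + n) / q) (count-⊎ (_≟ 0) q⊎[n,n+t]? (2 * n) zero∉) ⟩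
          count (_≟ 0) (2 * n) + count q⊎[n,n+t]? (2 * n) + (t + n) / q
            ≡⟨ cong (λ c → c + count q⊎[n,n+t]? (2 * n) + (t + n) / q)
               (count-≡ (<-≤-trans 1≤n n≤2n)) ⟩
          suc (count q⊎[n,n+t]? (2 * n) + (t + n) / q)
            ≡⟨ cong suc count-q⊎[n,n+t] ⟩
          suc (ceilDiv (2 * n) q + t)
            ≡⟨ +-suc _ t ⟨
          ceilDiv (2 * n) q + suc t ∎
          where
          open ≡-Reasoning
          zero∉ : ∀ y → y < 2 * n → y ≡ 0 → ¬ (y ≡ q ⊎ y ∈[ n , n + t ])
          zero∉ _ _ refl (inj₁ 0≡q) = <⇒≱ 1≤q (≤-reflexive (sym 0≡q))
          zero∉ _ _ refl (inj₂ (n≤0 , _)) = <⇒≱ 1≤n n≤0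

        case₃ : ∃ λ g → GMIs n t q g × (+ g ≡ + (2 + q * n) - + (ceilDiv (2 * n) q) +ℤ + ((t + n) / q))
        case₃ with GM+count≡qn+t+3 C₃? Covered⇔C₃
        ... | g , gm , size = g , gm , g+b≡a+c⇒g≡a-b+c (+-cancelʳ-≡ (suc t) _ _ (begin
          g + ceilDiv (2 * n) q + suc t
            ≡⟨ +-assoc g _ (suc t) ⟩
          g + (ceilDiv (2 * n) q + suc t)
            ≡⟨ cong (_+_ g) count-C₃ ⟨
          g + (count C₃? (2 * n) + (t + n) / q)
            ≡⟨ +-assoc g _ _ ⟨
          g + count C₃? (2 * n) + (t + n) / q
            ≡⟨ cong (_+ (t + n) / q) size ⟩
          3 + q * n + t + (t + n) / q
            ≡⟨ reorder (q * n) t ((t + n) / q) ⟩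
          2 + q * n + (t + n) / q + suc t ∎))
          where
          open ≡-Reasoning
          reorder : ∀ a t f → 3 + a + t + f ≡ 2 + a + f + suc t
          reorder = solve-∀

theorem4p4 : (q n t : ℕ) → .{{_ : NonZero q}} → 2 ≤ q → ceilDiv (n ∸ 1) 2 ≤ t → t < n → t ≢ 1 →
    ((q ≤ t + 1 → ∃ λ g → GMIs n t q g ×
        (+ g ≡ + (3 + (q ∸ 1) * n) - + (ceilDiv n q) +ℤ + t))
    × (t + 2 ≤ q → q ≤ n ∸ 1 → ∃ λ g → GMIs n t q g ×
        (+ g ≡ + (4 + (q ∸ 1) * n + q) - + (2 * ceilDiv n q) +ℤ + ((t + n) / q)
               - + (((t + n) / q) ⊔ ((1 + n / q) ⊓ t))))
    × (n ≤ q → ∃ λ g → GMIs n t q g ×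
        (+ g ≡ + (2 + q * n) - + (ceilDiv (2 * n) q) +ℤ + ((t + n) / q))))
theorem4p4 q n t 2≤q ⌈n∸1/2⌉≤t t<n _ =
    (λ q≤t+1 → case₁ n≤1+2t t<n 2≤q q≤t+1)
  , (λ t+2≤q q≤n∸1 → case₂ n≤1+2t t<n 2≤q t+2≤q (subst (_≤ n) (+-comm q 1) (m≤o∸n⇒m+n≤o q 0<n q≤n∸1)))
  , (λ n≤q → case₃ n≤1+2t t<n 2≤q n≤q)
  where
  0<n : 0 < n
  0<n = ≤-trans (s≤s z≤n) t<n
  n≤1+2t : n ≤ suc (2 * t)
  n≤1+2t = ⌈n∸1/2⌉≤t⇒n≤1+2t 0<n ⌈n∸1/2⌉≤t
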